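{- Let $Z$ be the $k\times k$ grid, for any integer $k\geq 2$, and let $\Gamma$ denote the set of vertices in the first row of $Z$. Let $(A,B)$ be any partition of the vertices of $Z$ with $A,B\neq\emptyset$. Then $|E(A,B)|\geq \min\{|A\cap\Gamma|,|B\cap\Gamma|\}+1$.
   Context: $E(A,B)$ denotes the set of edges of $Z$ with one endpoint in $A$ and the other in $B$. -}

module Defs where

open import Data.Nat using (ℕ; zero; suc; _+_; _≡ᵇ_)
open import Data.Bool using (Bool; true; false; _∧_; _∨_; not; _xor_)
open import Data.Fin using (Fin; toℕ)
open import Data.Product using (_×_; _,_; proj₁; proj₂)
open import Data.List using (List; length; filterᵇ; allFin; cartesianProduct)

-- Vertices of the k × k grid Z: (row , column).
Vertex : ℕ → Set
Vertex k = Fin k × Fin k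

-- Each edge of Z appears exactly once.
gridEdgeᵇ : ∀ {k} → Vertex k → Vertex k → Bool
gridEdgeᵇ (r , c) (r' , c') =
  ((toℕ r ≡ᵇ toℕ r') ∧ (suc (toℕ c) ≡ᵇ toℕ c'))
  ∨ ((toℕ c ≡ᵇ toℕ c') ∧ (suc (toℕ r) ≡ᵇ toℕ r'))

allVertices : ∀ k → List (Vertex k)
allVertices k = cartesianProduct (allFin k) (allFin k)

edges : ∀ k → List (Vertex k × Vertex k)
edges k = filterᵇ (λ e → gridEdgeᵇ (proj₁ e) (proj₂ e))
                 (cartesianProduct (allVertices k) (allVertices k))

-- A partition (A , B) of V(Z) is given by its indicator inA : A = inA⁻¹(true),
-- B = inA⁻¹(false).
-- |E(A,B)|: number of edges with one endpoint in A and the other in B.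
crossingCount : ∀ k → (Vertex k → Bool) → ℕ
crossingCount k inA =
  length (filterᵇ (λ e → inA (proj₁ e) xor inA (proj₂ e)) (edges k))

-- Γ = first row (row index 0).  countΓ k inA b = |{v ∈ Γ : inA v = b}|,
-- so countΓ k inA true = |A ∩ Γ| and countΓ k inA false = |B ∩ Γ|.
countΓ : ∀ k → (Vertex k → Bool) → Bool → ℕ
countΓ k inA b =
  length (filterᵇ (λ v → (toℕ (proj₁ v) ≡ᵇ 0) ∧ not (inA v xor b))
                  (allVertices k))

-- Every row or column whose cells are not all of one colour contributes a
-- crossing edge between two consecutive cells, and distinct rows and columns
-- contribute distinct edges.  Let m be the smaller colour count on Γ.  If Γ is
-- monochromatic then m = 0 and one crossing edge exists since A, B ≠ ∅.
-- Otherwise the first row already contributes one edge, and either there are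
-- monochromatic columns of both colours, so that all k > m rows are split, or
-- some colour y has no monochromatic column, so that each of the ≥ m columns
-- whose top cell has colour y is split.
module Submission where

open import Algebra.Properties.CommutativeSemigroup using (interchange)
open import Data.Bool using (Bool; true; false; not; _∧_; _∨_; _xor_; T)
open import Data.Bool.Properties using (not-¬; T-≡; T-∧) renaming (_≟_ to _≟ᵇ_)
open import Data.Empty using (⊥; ⊥-elim)
open import Data.Fin using (Fin; zero; suc; toℕ; inject₁)
open import Data.Fin.Properties using (toℕ-inject₁; any?; all?; ¬∀⟶∃¬)
open import Data.List using (List; []; _∷_; _++_; map; length; filterᵇ; allFin; cartesianProduct)
open import Data.List.Membership.Propositional using (_∈_)
open import Data.List.Membership.Propositional.Properties using (∈-allFin)
open import Data.List.Properties using (length-tabulate; map-tabulate)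
open import Data.List.Relation.Unary.Any using (here; there)
open import Data.Nat using (ℕ; zero; suc; _+_; _≤_; _<_; _⊓_; _≡ᵇ_; z≤n; s≤s)
open import Data.Nat.Properties
open import Data.Product using (∃; _×_; _,_; proj₁; proj₂)
open import Level using (Level)
open import Function using (id; Equivalence)
open import Relation.Binary.PropositionalEquality
open import Relation.Nullary using (¬_; Dec; yes; no; contradiction)

open import Defs

private
  variable
    a b : Level
    A : Set a
    B : Set b

iverson : Bool → ℕ
iverson true  = 1
iverson false = 0

∑ : List A → (A → ℕ) → ℕ
∑ []       f = 0
∑ (x ∷ xs) f = f x + ∑ xs f

infix 5 ∑
syntax ∑ xs (λ x → e) = ∑[ x ∈ xs ] e

∑-cong : ∀ (xs : List A) {f g : A → ℕ} → (∀ x → f x ≡ g x) → ∑ xs f ≡ ∑ xs g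
∑-cong []       f≡g = refl
∑-cong (x ∷ xs) f≡g = cong₂ _+_ (f≡g x) (∑-cong xs f≡g)

∑-mono : ∀ (xs : List A) {f g : A → ℕ} → (∀ x → f x ≤ g x) → ∑ xs f ≤ ∑ xs g
∑-mono []       f≤g = z≤n
∑-mono (x ∷ xs) f≤g = +-mono-≤ (f≤g x) (∑-mono xs f≤g)

∑-zero : ∀ (xs : List A) {f : A → ℕ} → (∀ x → f x ≡ 0) → ∑ xs f ≡ 0
∑-zero []       f≡0 = refl
∑-zero (x ∷ xs) f≡0 = cong₂ _+_ (f≡0 x) (∑-zero xs f≡0)

∑-const-1 : ∀ (xs : List A) → (∑[ _ ∈ xs ] 1) ≡ length xs
∑-const-1 []       = refl
∑-const-1 (x ∷ xs) = cong suc (∑-const-1 xs)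

∑-allFin-1 : ∀ k → (∑[ _ ∈ allFin k ] 1) ≡ k
∑-allFin-1 k = trans (∑-const-1 (allFin k)) (length-tabulate id)

∑-distrib-+ : ∀ (xs : List A) (f g : A → ℕ) →
              (∑[ x ∈ xs ] (f x + g x)) ≡ ∑ xs f + ∑ xs g
∑-distrib-+ []       f g = refl
∑-distrib-+ (x ∷ xs) f g =
  trans (cong (f x + g x +_) (∑-distrib-+ xs f g))
        (interchange +-commutativeSemigroup (f x) (g x) (∑ xs f) (∑ xs g))

∑-++ : ∀ (xs ys : List A) (f : A → ℕ) → ∑ (xs ++ ys) f ≡ ∑ xs f + ∑ ys f
∑-++ []       ys f = refl
∑-++ (x ∷ xs) ys f = trans (cong (f x +_) (∑-++ xs ys f)) (sym (+-assoc (f x) _ _))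

∑-map : ∀ (g : A → B) (xs : List A) (f : B → ℕ) → ∑ (map g xs) f ≡ (∑[ x ∈ xs ] f (g x))
∑-map g []       f = refl
∑-map g (x ∷ xs) f = cong (f (g x) +_) (∑-map g xs f)

∑-allFin-suc : ∀ {n} (f : Fin (suc n) → ℕ) →
               ∑ (allFin (suc n)) f ≡ f zero + (∑[ i ∈ allFin n ] f (suc i))
∑-allFin-suc {n} f =
  cong (f zero +_) (trans (cong (λ is → ∑ is f) (sym (map-tabulate id suc)))
                          (∑-map suc (allFin n) f))

∑-cartesianProduct : ∀ (xs : List A) (ys : List B) (f : A × B → ℕ) →
                     ∑ (cartesianProduct xs ys) f ≡ (∑[ x ∈ xs ] ∑[ y ∈ ys ] f (x , y))
∑-cartesianProduct []       ys f = refl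
∑-cartesianProduct (x ∷ xs) ys f =
  trans (∑-++ (map (x ,_) ys) _ f)
        (cong₂ _+_ (∑-map (x ,_) ys f) (∑-cartesianProduct xs ys f))

∑-comm : ∀ (xs : List A) (ys : List B) (f : A → B → ℕ) →
         (∑[ x ∈ xs ] ∑[ y ∈ ys ] f x y) ≡ (∑[ y ∈ ys ] ∑[ x ∈ xs ] f x y)
∑-comm []       ys f = sym (∑-zero ys (λ _ → refl))
∑-comm (x ∷ xs) ys f =
  trans (cong (∑ ys (f x) +_) (∑-comm xs ys f)) (sym (∑-distrib-+ ys (f x) _))

term≤∑ : ∀ {xs : List A} (f : A → ℕ) {x} → x ∈ xs → f x ≤ ∑ xs f
term≤∑ f {x} (here refl) = m≤m+n (f x) _
term≤∑ f (there {y} x∈xs) = ≤-trans (term≤∑ f x∈xs) (m≤n+m _ (f y))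

length-filterᵇ : ∀ (p : A → Bool) xs → length (filterᵇ p xs) ≡ (∑[ x ∈ xs ] iverson (p x))
length-filterᵇ p []       = refl
length-filterᵇ p (x ∷ xs) with p x
... | true  = cong suc (length-filterᵇ p xs)
... | false = length-filterᵇ p xs

filterᵇ-filterᵇ : ∀ (p q : A → Bool) xs →
                  filterᵇ q (filterᵇ p xs) ≡ filterᵇ (λ x → p x ∧ q x) xs
filterᵇ-filterᵇ p q []       = refl
filterᵇ-filterᵇ p q (x ∷ xs) with p x
... | false = filterᵇ-filterᵇ p q xs
... | true with q x
...   | true  = cong (x ∷_) (filterᵇ-filterᵇ p q xs)
...   | false = filterᵇ-filterᵇ p q xs

≡⇒≡ᵇ≡true : ∀ {m n} → m ≡ n → (m ≡ᵇ n) ≡ true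
≡⇒≡ᵇ≡true {m} {n} m≡n = Equivalence.to T-≡ (≡⇒≡ᵇ m n m≡n)

iverson-∨-disjoint : ∀ p q x → (T p → T q → ⊥) →
                     iverson (p ∧ x) + iverson (q ∧ x) ≤ iverson ((p ∨ q) ∧ x)
iverson-∨-disjoint true  true  x     p∩q = ⊥-elim (p∩q _ _)
iverson-∨-disjoint true  false true  _   = ≤-refl
iverson-∨-disjoint true  false false _   = ≤-refl
iverson-∨-disjoint false q     x     _   = ≤-refl

0<iverson-xor : ∀ {x y} → x ≢ y → 0 < iverson (x xor y)
0<iverson-xor {true}  {true}  x≢y = contradiction refl x≢y
0<iverson-xor {true}  {false} _   = s≤s z≤n
0<iverson-xor {false} {true}  _   = s≤s z≤n
0<iverson-xor {false} {false} x≢y = contradiction refl x≢y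

0<iverson-not-xor : ∀ {x y} → x ≡ y → 0 < iverson (not (x xor y))
0<iverson-not-xor {true}  refl = s≤s z≤n
0<iverson-not-xor {false} refl = s≤s z≤n

iverson-not-xor≤ : ∀ x y {n} → (x ≡ y → 0 < n) → iverson (not (x xor y)) ≤ n
iverson-not-xor≤ true  true  0<n = 0<n refl
iverson-not-xor≤ true  false _   = z≤n
iverson-not-xor≤ false true  _   = z≤n
iverson-not-xor≤ false false 0<n = 0<n refl

iverson-not-xor-complement : ∀ x y → iverson (not (x xor y)) + iverson (not (x xor not y)) ≡ 1
iverson-not-xor-complement true  true  = refl
iverson-not-xor-complement true  false = refl
iverson-not-xor-complement false true  = refl
iverson-not-xor-complement false false = refl

-- The number of i with h i ≠ h (i + 1), encoded as adjacency is in gridEdgeᵇ.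
transitions : ∀ {k} → (Fin k → Bool) → ℕ
transitions {k} h =
  ∑[ i ∈ allFin k ] ∑[ j ∈ allFin k ] iverson ((suc (toℕ i) ≡ᵇ toℕ j) ∧ (h i xor h j))

iverson-step≤transitions : ∀ {n} (h : Fin (suc n) → Bool) (i : Fin n) →
                           iverson (h (inject₁ i) xor h (suc i)) ≤ transitions h
iverson-step≤transitions h i =
  ≤-trans (≤-reflexive (cong (λ b → iverson (b ∧ (h (inject₁ i) xor h (suc i))))
                             (sym (≡⇒≡ᵇ≡true (toℕ-inject₁ i)))))
    (≤-trans (term≤∑ (λ j → iverson ((suc (toℕ (inject₁ i)) ≡ᵇ toℕ j) ∧ (h (inject₁ i) xor h j)))
                     (∈-allFin (suc i)))
             (term≤∑ _ (∈-allFin (inject₁ i))))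

steps-agree⇒constant : ∀ {n} (h : Fin (suc n) → Bool) →
                       (∀ i → h (inject₁ i) ≡ h (suc i)) → ∀ i → h i ≡ h zero
steps-agree⇒constant         h agree zero    = refl
steps-agree⇒constant {suc n} h agree (suc i) =
  trans (steps-agree⇒constant (λ j → h (suc j)) (λ j → agree (suc j)) i) (sym (agree zero))

0<transitions : ∀ {k} (h : Fin k → Bool) {i j} → h i ≢ h j → 0 < transitions h
0<transitions {suc n} h {i} {j} hi≢hj with all? (λ l → h (inject₁ l) ≟ᵇ h (suc l))
... | yes agree = contradiction (trans (steps-agree⇒constant h agree i)
                                       (sym (steps-agree⇒constant h agree j))) hi≢hj
... | no ¬agree =
  let l , step≢ = ¬∀⟶∃¬ n _ (λ l → h (inject₁ l) ≟ᵇ h (suc l)) ¬agree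
  in <-≤-trans (0<iverson-xor step≢) (iverson-step≤transitions h l)

occurrences : ∀ {k} → (Fin k → Bool) → Bool → ℕ
occurrences {k} h y = ∑[ i ∈ allFin k ] iverson (not (h i xor y))

occurrences-complement : ∀ {k} (h : Fin k → Bool) y → occurrences h y + occurrences h (not y) ≡ k
occurrences-complement {k} h y = begin
  occurrences h y + occurrences h (not y)
    ≡⟨ ∑-distrib-+ (allFin k) _ _ ⟨
  (∑[ i ∈ allFin k ] (iverson (not (h i xor y)) + iverson (not (h i xor not y))))
    ≡⟨ ∑-cong (allFin k) (λ i → iverson-not-xor-complement (h i) y) ⟩
  (∑[ _ ∈ allFin k ] 1)
    ≡⟨ ∑-allFin-1 k ⟩
  k ∎
  where open ≡-Reasoning

occurrences≡0 : ∀ {k} (h : Fin k → Bool) y → ¬ ∃ (λ i → h i ≡ y) → occurrences h y ≡ 0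
occurrences≡0 {k} h y absent =
  ∑-zero (allFin k) (λ i → n≤0⇒n≡0 (iverson-not-xor≤ (h i) y (λ hi≡y → contradiction (i , hi≡y) absent)))

0<occurrences : ∀ {k} (h : Fin k → Bool) {i} y → h i ≡ y → 0 < occurrences h y
0<occurrences h {i} y hi≡y = <-≤-trans (0<iverson-not-xor hi≡y) (term≤∑ _ (∈-allFin i))

occurrences<k : ∀ {k} (h : Fin k → Bool) {i} y → h i ≡ not y → occurrences h y < k
occurrences<k {k} h y hi≡¬y = begin-strict
  occurrences h y                         <⟨ m<m+n _ (0<occurrences h (not y) hi≡¬y) ⟩
  occurrences h y + occurrences h (not y) ≡⟨ occurrences-complement h y ⟩
  k                                       ∎
  where open ≤-Reasoning

⊓-occurrences≤ : ∀ {k} (h : Fin k → Bool) y → occurrences h true ⊓ occurrences h false ≤ occurrences h y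
⊓-occurrences≤ h true  = m⊓n≤m _ _
⊓-occurrences≤ h false = m⊓n≤n _ _

horizontalᵇ verticalᵇ : ∀ {k} → Vertex k → Vertex k → Bool
horizontalᵇ (r , c) (r′ , c′) = (toℕ r ≡ᵇ toℕ r′) ∧ (suc (toℕ c) ≡ᵇ toℕ c′)
verticalᵇ   (r , c) (r′ , c′) = (toℕ c ≡ᵇ toℕ c′) ∧ (suc (toℕ r) ≡ᵇ toℕ r′)

horizontalᵇ-verticalᵇ-disjoint : ∀ {k} (v w : Vertex k) → T (horizontalᵇ v w) → T (verticalᵇ v w) → ⊥
horizontalᵇ-verticalᵇ-disjoint (_ , c) (_ , c′) h v =
  1+n≢n (trans (≡ᵇ⇒≡ (suc (toℕ c)) (toℕ c′) (proj₂ (Equivalence.to T-∧ h)))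
               (sym (≡ᵇ⇒≡ (toℕ c) (toℕ c′) (proj₁ (Equivalence.to (T-∧ {toℕ c ≡ᵇ toℕ c′}) v)))))

row : ∀ {k} → (Vertex k → Bool) → Fin k → Fin k → Bool
row inA r c = inA (r , c)

column : ∀ {k} → (Vertex k → Bool) → Fin k → Fin k → Bool
column inA c r = inA (r , c)

rowTransitions : ∀ {k} → (Vertex k → Bool) → ℕ
rowTransitions {k} inA = ∑[ r ∈ allFin k ] transitions (row inA r)

columnTransitions : ∀ {k} → (Vertex k → Bool) → ℕ
columnTransitions {k} inA = ∑[ c ∈ allFin k ] transitions (column inA c)

module _ {k : ℕ} (inA : Vertex k → Bool) where

  private
    crossing : Vertex k → Vertex k → ℕ
    crossing v w = iverson (gridEdgeᵇ v w ∧ (inA v xor inA w))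

    horizontal vertical : Fin k → Fin k → Fin k → Fin k → ℕ
    horizontal r c r′ c′ = iverson (horizontalᵇ (r , c) (r′ , c′) ∧ (inA (r , c) xor inA (r′ , c′)))
    vertical   r c r′ c′ = iverson (verticalᵇ (r , c) (r′ , c′) ∧ (inA (r , c) xor inA (r′ , c′)))

    rightward downward : Fin k → Fin k → ℕ
    rightward r c =
      ∑[ c′ ∈ allFin k ] iverson ((suc (toℕ c) ≡ᵇ toℕ c′) ∧ (inA (r , c) xor inA (r , c′)))
    downward r c =
      ∑[ r′ ∈ allFin k ] iverson ((suc (toℕ r) ≡ᵇ toℕ r′) ∧ (inA (r , c) xor inA (r′ , c)))

  crossingCount≡∑ : crossingCount k inA ≡
    (∑[ r ∈ allFin k ] ∑[ c ∈ allFin k ] ∑[ r′ ∈ allFin k ] ∑[ c′ ∈ allFin k ] crossing (r , c) (r′ , c′))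
  crossingCount≡∑ = begin
    crossingCount k inA
      ≡⟨ cong length (filterᵇ-filterᵇ _ _ pairs) ⟩
    length (filterᵇ (λ e → gridEdgeᵇ (proj₁ e) (proj₂ e) ∧ (inA (proj₁ e) xor inA (proj₂ e))) pairs)
      ≡⟨ length-filterᵇ _ pairs ⟩
    (∑[ e ∈ pairs ] crossing (proj₁ e) (proj₂ e))
      ≡⟨ ∑-cartesianProduct (allVertices k) (allVertices k) _ ⟩
    (∑[ v ∈ allVertices k ] ∑[ w ∈ allVertices k ] crossing v w)
      ≡⟨ ∑-cartesianProduct (allFin k) (allFin k) _ ⟩
    (∑[ r ∈ allFin k ] ∑[ c ∈ allFin k ] ∑[ w ∈ allVertices k ] crossing (r , c) w)
      ≡⟨ ∑-cong (allFin k) (λ r → ∑-cong (allFin k) (λ c → ∑-cartesianProduct (allFin k) (allFin k) _)) ⟩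
    (∑[ r ∈ allFin k ] ∑[ c ∈ allFin k ] ∑[ r′ ∈ allFin k ] ∑[ c′ ∈ allFin k ] crossing (r , c) (r′ , c′)) ∎
    where
    open ≡-Reasoning
    pairs = cartesianProduct (allVertices k) (allVertices k)

  rightward+downward≤crossings : ∀ r c →
    rightward r c + downward r c ≤ (∑[ r′ ∈ allFin k ] ∑[ c′ ∈ allFin k ] crossing (r , c) (r′ , c′))
  rightward+downward≤crossings r c = begin
    rightward r c + downward r c
      ≤⟨ +-mono-≤ rightward≤ downward≤ ⟩
    (∑[ r′ ∈ allFin k ] ∑[ c′ ∈ allFin k ] horizontal r c r′ c′) +
    (∑[ r′ ∈ allFin k ] ∑[ c′ ∈ allFin k ] vertical r c r′ c′)
      ≡⟨ ∑-distrib-+ (allFin k) _ _ ⟨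
    (∑[ r′ ∈ allFin k ] ((∑[ c′ ∈ allFin k ] horizontal r c r′ c′) + (∑[ c′ ∈ allFin k ] vertical r c r′ c′)))
      ≡⟨ ∑-cong (allFin k) (λ r′ → ∑-distrib-+ (allFin k) _ _) ⟨
    (∑[ r′ ∈ allFin k ] ∑[ c′ ∈ allFin k ] (horizontal r c r′ c′ + vertical r c r′ c′))
      ≤⟨ ∑-mono (allFin k) (λ r′ → ∑-mono (allFin k) (λ c′ →
           iverson-∨-disjoint (horizontalᵇ (r , c) (r′ , c′)) (verticalᵇ (r , c) (r′ , c′)) _
             (horizontalᵇ-verticalᵇ-disjoint (r , c) (r′ , c′)))) ⟩
    (∑[ r′ ∈ allFin k ] ∑[ c′ ∈ allFin k ] crossing (r , c) (r′ , c′)) ∎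
    where
    open ≤-Reasoning
    rightward≤ : rightward r c ≤ (∑[ r′ ∈ allFin k ] ∑[ c′ ∈ allFin k ] horizontal r c r′ c′)
    rightward≤ = ≤-trans
      (≤-reflexive (∑-cong (allFin k) (λ c′ →
        cong (λ b → iverson ((b ∧ (suc (toℕ c) ≡ᵇ toℕ c′)) ∧ (inA (r , c) xor inA (r , c′))))
             (sym (≡⇒≡ᵇ≡true {toℕ r} refl)))))
      (term≤∑ (λ r′ → ∑[ c′ ∈ allFin k ] horizontal r c r′ c′) (∈-allFin r))
    downward≤ : downward r c ≤ (∑[ r′ ∈ allFin k ] ∑[ c′ ∈ allFin k ] vertical r c r′ c′)
    downward≤ = ∑-mono (allFin k) (λ r′ → ≤-trans
      (≤-reflexive (cong (λ b → iverson ((b ∧ (suc (toℕ r) ≡ᵇ toℕ r′)) ∧ (inA (r , c) xor inA (r′ , c))))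
                         (sym (≡⇒≡ᵇ≡true {toℕ c} refl))))
      (term≤∑ (vertical r c r′) (∈-allFin c)))

  transitions≤crossingCount : rowTransitions inA + columnTransitions inA ≤ crossingCount k inA
  transitions≤crossingCount = begin
    rowTransitions inA + columnTransitions inA
      ≡⟨ cong (rowTransitions inA +_) (∑-comm (allFin k) (allFin k) downward) ⟨
    (∑[ r ∈ allFin k ] ∑[ c ∈ allFin k ] rightward r c) + (∑[ r ∈ allFin k ] ∑[ c ∈ allFin k ] downward r c)
      ≡⟨ ∑-distrib-+ (allFin k) _ _ ⟨
    (∑[ r ∈ allFin k ] ((∑[ c ∈ allFin k ] rightward r c) + (∑[ c ∈ allFin k ] downward r c)))
      ≡⟨ ∑-cong (allFin k) (λ r → ∑-distrib-+ (allFin k) _ _) ⟨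
    (∑[ r ∈ allFin k ] ∑[ c ∈ allFin k ] (rightward r c + downward r c))
      ≤⟨ ∑-mono (allFin k) (λ r → ∑-mono (allFin k) (rightward+downward≤crossings r)) ⟩
    (∑[ r ∈ allFin k ] ∑[ c ∈ allFin k ] ∑[ r′ ∈ allFin k ] ∑[ c′ ∈ allFin k ] crossing (r , c) (r′ , c′))
      ≡⟨ crossingCount≡∑ ⟨
    crossingCount k inA ∎
    where open ≤-Reasoning

countΓ≡occurrences : ∀ {n} (inA : Vertex (suc n) → Bool) y →
                     countΓ (suc n) inA y ≡ occurrences (row inA zero) y
countΓ≡occurrences {n} inA y = begin
  countΓ (suc n) inA y
    ≡⟨ length-filterᵇ _ (allVertices (suc n)) ⟩
  (∑[ v ∈ allVertices (suc n) ] first-row-of-colour v)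
    ≡⟨ ∑-cartesianProduct (allFin (suc n)) (allFin (suc n)) _ ⟩
  (∑[ r ∈ allFin (suc n) ] ∑[ c ∈ allFin (suc n) ] first-row-of-colour (r , c))
    ≡⟨ ∑-allFin-suc (λ r → ∑[ c ∈ allFin (suc n) ] first-row-of-colour (r , c)) ⟩
  occurrences (row inA zero) y + (∑[ r ∈ allFin n ] ∑[ c ∈ allFin (suc n) ] 0)
    ≡⟨ cong (occurrences (row inA zero) y +_) (∑-zero (allFin n) (λ _ → ∑-zero (allFin (suc n)) (λ _ → refl))) ⟩
  occurrences (row inA zero) y + 0
    ≡⟨ +-identityʳ _ ⟩
  occurrences (row inA zero) y ∎
  where
  open ≡-Reasoning
  first-row-of-colour : Vertex (suc n) → ℕ
  first-row-of-colour v = iverson ((toℕ (proj₁ v) ≡ᵇ 0) ∧ not (inA v xor y))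

module _ {k : ℕ} (inA : Vertex k → Bool) where

  0<rowTransitions : ∀ r {c c′} → inA (r , c) ≢ inA (r , c′) → 0 < rowTransitions inA
  0<rowTransitions r cells≢ = <-≤-trans (0<transitions (row inA r) cells≢) (term≤∑ _ (∈-allFin r))

  0<columnTransitions : ∀ c {r r′} → inA (r , c) ≢ inA (r′ , c) → 0 < columnTransitions inA
  0<columnTransitions c cells≢ = <-≤-trans (0<transitions (column inA c) cells≢) (term≤∑ _ (∈-allFin c))

  0<rowTransitions+columnTransitions : ∀ v w → inA v ≢ inA w → 0 < rowTransitions inA + columnTransitions inA
  0<rowTransitions+columnTransitions (r , c) (r′ , c′) v≢w with inA (r , c′) ≟ᵇ inA (r , c)
  ... | yes same = <-≤-trans (0<columnTransitions c′ (λ e → v≢w (trans (sym same) e))) (m≤n+m _ _)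
  ... | no  diff = <-≤-trans (0<rowTransitions r (λ e → diff (sym e))) (m≤m+n _ _)

  Monochromatic : Fin k → Bool → Set
  Monochromatic c y = ∀ r → column inA c r ≡ y

  monochromatic? : ∀ c y → Dec (Monochromatic c y)
  monochromatic? c y = all? (λ r → column inA c r ≟ᵇ y)

  k≤rowTransitions : ∀ {c c′} → Monochromatic c true → Monochromatic c′ false → k ≤ rowTransitions inA
  k≤rowTransitions {c} {c′} allTrue allFalse = begin
    k                     ≡⟨ ∑-allFin-1 k ⟨
    (∑[ _ ∈ allFin k ] 1) ≤⟨ ∑-mono (allFin k) (λ r → 0<transitions (row inA r) {c} {c′}
                               (λ e → not-¬ refl (trans (sym (allTrue r)) (trans e (allFalse r))))) ⟩
    rowTransitions inA    ∎
    where open ≤-Reasoning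

module _ {n : ℕ} (inA : Vertex (suc n) → Bool) where

  private
    top : Fin (suc n) → Bool
    top = row inA zero

    minΓ : ℕ
    minΓ = occurrences top true ⊓ occurrences top false

    allTransitions : ℕ
    allTransitions = rowTransitions inA + columnTransitions inA

  occurrences≤columnTransitions : ∀ y → ¬ ∃ (λ c → Monochromatic inA c y) →
                                  occurrences top y ≤ columnTransitions inA
  occurrences≤columnTransitions y none = ∑-mono (allFin (suc n)) λ c →
    iverson-not-xor≤ (top c) y λ top≡y →
      let r , r≢y = ¬∀⟶∃¬ (suc n) _ (λ r → column inA c r ≟ᵇ y) (λ mono → none (c , mono))
      in 0<transitions (column inA c) {r} {zero} (λ e → r≢y (trans e top≡y))

  minΓ<allTransitions-bichromatic : ∀ {cT cF} → top cT ≡ true → top cF ≡ false → minΓ < allTransitions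
  minΓ<allTransitions-bichromatic topT topF =
    by-columns (any? (λ c → monochromatic? inA c true)) (any? (λ c → monochromatic? inA c false))
    where
    0<rows : 0 < rowTransitions inA
    0<rows = 0<rowTransitions inA zero (λ e → not-¬ refl (trans (sym topT) (trans e topF)))

    no-monochromatic-column : ∀ y → ¬ ∃ (λ c → Monochromatic inA c y) → minΓ < allTransitions
    no-monochromatic-column y none =
      +-mono-≤ 0<rows (≤-trans (⊓-occurrences≤ top y) (occurrences≤columnTransitions y none))

    by-columns : Dec (∃ λ c → Monochromatic inA c true) → Dec (∃ λ c → Monochromatic inA c false) →
                 minΓ < allTransitions
    by-columns (yes (_ , allTrue)) (yes (_ , allFalse)) = begin-strict
      minΓ                 ≤⟨ m⊓n≤m _ _ ⟩
      occurrences top true <⟨ occurrences<k top true topF ⟩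
      suc n                ≤⟨ k≤rowTransitions inA allTrue allFalse ⟩
      rowTransitions inA   ≤⟨ m≤m+n _ _ ⟩
      allTransitions       ∎
      where open ≤-Reasoning
    by-columns (no none) _        = no-monochromatic-column true none
    by-columns _        (no none) = no-monochromatic-column false none

  minΓ<allTransitions : ∃ (λ a → inA a ≡ true) → ∃ (λ b → inA b ≡ false) → minΓ < allTransitions
  minΓ<allTransitions (a , a∈A) (b , b∈B) =
    by-top-row (any? (λ c → top c ≟ᵇ true)) (any? (λ c → top c ≟ᵇ false))
    where
    monochromatic-top : ∀ y → ¬ ∃ (λ c → top c ≡ y) → minΓ < allTransitions
    monochromatic-top y absent =
      ≤-<-trans (⊓-occurrences≤ top y)
        (subst (_< allTransitions) (sym (occurrences≡0 top y absent))
               (0<rowTransitions+columnTransitions inA a b (λ e → not-¬ refl (trans (sym a∈A) (trans e b∈B)))))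

    by-top-row : Dec (∃ λ c → top c ≡ true) → Dec (∃ λ c → top c ≡ false) → minΓ < allTransitions
    by-top-row (yes (_ , topT)) (yes (_ , topF)) = minΓ<allTransitions-bichromatic topT topF
    by-top-row (no absent) _                     = monochromatic-top true absent
    by-top-row _           (no absent)           = monochromatic-top false absent

claim2p16 : (k : ℕ) → 2 ≤ k → (inA : Vertex k → Bool) →
    ∃ (λ a → inA a ≡ true) → ∃ (λ b → inA b ≡ false) →
    (countΓ k inA true ⊓ countΓ k inA false) + 1 ≤ crossingCount k inA
claim2p16 (suc n) _ inA A-nonempty B-nonempty = begin
  countΓ (suc n) inA true ⊓ countΓ (suc n) inA false + 1
    ≡⟨ cong₂ (λ p q → p ⊓ q + 1) (countΓ≡occurrences inA true) (countΓ≡occurrences inA false) ⟩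
  occurrences (row inA zero) true ⊓ occurrences (row inA zero) false + 1
    ≡⟨ +-comm _ 1 ⟩
  suc (occurrences (row inA zero) true ⊓ occurrences (row inA zero) false)
    ≤⟨ minΓ<allTransitions inA A-nonempty B-nonempty ⟩
  rowTransitions inA + columnTransitions inA
    ≤⟨ transitions≤crossingCount inA ⟩
  crossingCount (suc n) inA ∎
  where open ≤-Reasoning
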